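{- Let $Y$ be a Young diagram with row lengths $a_1\ge\cdots\ge a_m\ge 0$. For any 2-cover $P$ of $H(Y)$ there exists a 2-cover $P'$ of $H(Y)$ with $|P'|=|P|$ such that $P'\cap(C\times S)$ is closed down.
   Context: $H(Y)$ is the tripartite 3-uniform hypergraph with sides $R=\{r_1,\dots,r_m\}$, $C=\{c_1,\dots,c_{a_1}\}$, $S=\{s_1,\dots,s_{a_1}\}$ and edge set $\bigcup_{i=1}^m\{\{r_i,c_j,s_k\}: 1\le j,k\le a_i\}$. For disjoint sets $A,B$, $A\times B=\{\{a,b\}: a\in A,b\in B\}$. A 2-cover of $H(Y)$ is a set $P\subseteq (R\times C)\cup(R\times S)\cup(C\times S)$ such that every edge of $H(Y)$ contains at least one pair of $P$. A set $\Gamma\subseteq C\times S$ is closed down if $\{c_p,s_q\}\in\Gamma$ implies $\{c_{p'},s_{q'}\}\in\Gamma$ for all $p'\le p$, $q'\le q$. -}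

module Defs where

open import Data.Nat using (ℕ; zero; suc; _≤_; _<_)
open import Data.Fin using (Fin; toℕ)
import Data.Fin as Fin
open import Data.List using (List)
open import Data.List.Membership.Propositional using (_∈_)
open import Data.Sum using (_⊎_)

-- A Young diagram with m rows: row lengths a 0 ≥ a 1 ≥ ... ≥ a (m-1) ≥ 0
-- (0-indexed; the paper's a_{i+1} is our a i).
IsYoung : (m : ℕ) → (Fin m → ℕ) → Set
IsYoung m a = ∀ (i j : Fin m) → toℕ i ≤ toℕ j → a j ≤ a i

width : (m : ℕ) → (Fin m → ℕ) → ℕ
width zero    a = 0
width (suc m) a = a Fin.zero

-- Pairs of vertices of H(Y) from R×C, R×S, C×S.
-- R = Fin m, C = Fin w, S = Fin w (w = width m a); c_j, s_k 0-indexed.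
data Pair (m w : ℕ) : Set where
  rc : Fin m → Fin w → Pair m w
  rs : Fin m → Fin w → Pair m w
  cs : Fin w → Fin w → Pair m w

-- P is a 2-cover of H(Y): every edge {r_i, c_j, s_k} with j,k < a_i
-- (0-indexed) contains a pair of P.
Is2Cover : (m : ℕ) (a : Fin m → ℕ) → List (Pair m (width m a)) → Set
Is2Cover m a P =
  ∀ (i : Fin m) (j k : Fin (width m a)) → toℕ j < a i → toℕ k < a i →
    (rc i j ∈ P) ⊎ ((rs i k ∈ P) ⊎ (cs j k ∈ P))

ClosedDownCS : {m w : ℕ} → List (Pair m w) → Set
ClosedDownCS {m} {w} P =
  ∀ (j k j′ k′ : Fin w) → cs j k ∈ P → toℕ j′ ≤ toℕ j → toℕ k′ ≤ toℕ k →
    cs j′ k′ ∈ P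

-- For columns p < q, compress a 2-cover P: move each pair {c_q, s_k} to
-- {c_p, s_k} when the latter is missing, and in every row i with q < a_i move
-- {r_i, c_p} to {r_i, c_q} when the latter is missing.  On P this map is
-- injective and its image is again a 2-cover; it strictly lowers the weight
-- Σ (j + k) over the pairs {c_j, s_k} as soon as one of them moves.  Exchanging
-- the roles of C and S gives the same for S.  Compressing until nothing moves
-- leaves a cover of the same size that contains, with each {c_j, s_k}, also
-- {c_(j-1), s_k} and {c_j, s_(k-1)}, and is therefore closed down.
module Submission where

open import Defs
open import Data.Nat using (ℕ; _+_; _<?_)
import Data.Nat as ℕ
open import Data.Nat.Properties using (≤-refl; <-trans; <⇒≤; +-comm; +-mono-≤; +-mono-<-≤; +-mono-≤-<; +-monoˡ-≤; +-monoˡ-<)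
open import Data.Nat.Induction using (<-wellFounded)
open import Data.Nat.ListAction using (sum)
open import Data.Fin using (Fin; toℕ; pred; zero; suc; _≤_; _<_)
open import Data.Fin.Properties using (_≟_; ≤-antisym; <⇒≢; ≤∧≢⇒<; <⇒≤pred; pred<)
import Data.Fin.Induction as Fin
open import Data.List using (List; []; _∷_; map; length)
open import Data.List.Properties using (length-map; map-∘; map-cong)
open import Data.List.Relation.Unary.All as All using (All; all?)
open import Data.List.Relation.Unary.AllPairs using ([]; _∷_)
import Data.List.Relation.Unary.All.Properties as Allₚ
open import Data.List.Relation.Unary.Any using (here; there)
open import Data.List.Relation.Unary.Unique.Propositional using (Unique)
import Data.List.Relation.Unary.Unique.Propositional.Properties as Unique
open import Data.List.Membership.Propositional using (_∈_; _∉_; find)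
open import Data.List.Membership.Propositional.Properties using (∈-map⁺; ∈-map⁻)
import Data.List.Membership.DecPropositional as DecMembership
open import Data.Product using (Σ; ∃; _×_; _,_; proj₁; proj₂)
open import Data.Sum using (_⊎_; inj₁; inj₂)
open import Data.Unit using (⊤; tt)
open import Data.Empty using (⊥)
open import Function using (_∘_)
open import Induction.WellFounded using (Acc; acc)
open import Relation.Nullary using (yes; no; ¬_; contradiction)
open import Relation.Nullary.Decidable using (map′; _×-dec_)
open import Relation.Unary using (Decidable)
open import Relation.Binary.Definitions using (DecidableEquality)
open import Relation.Binary.PropositionalEquality using (_≡_; refl; sym; trans; cong; subst; subst₂)

module _ {A B : Set} (f : A → B) where

  unique-map⁺ : ∀ {xs} → (∀ {x y} → x ∈ xs → y ∈ xs → f x ≡ f y → x ≡ y) →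
                Unique xs → Unique (map f xs)
  unique-map⁺ {[]}     _   []          = []
  unique-map⁺ {x ∷ xs} inj (x∉xs ∷ xs!) =
    Allₚ.map⁺ (All.tabulate λ y∈xs fx≡fy → All.lookup x∉xs y∈xs (inj (here refl) (there y∈xs) fx≡fy))
    ∷ unique-map⁺ (λ x∈ y∈ → inj (there x∈) (there y∈)) xs!

module _ {A : Set} {f g : A → ℕ} (f≤g : ∀ x → f x ℕ.≤ g x) where

  sum-map-mono : ∀ xs → sum (map f xs) ℕ.≤ sum (map g xs)
  sum-map-mono []       = ≤-refl
  sum-map-mono (x ∷ xs) = +-mono-≤ (f≤g x) (sum-map-mono xs)

  sum-map-strict : ∀ {x xs} → x ∈ xs → f x ℕ.< g x → sum (map f xs) ℕ.< sum (map g xs)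
  sum-map-strict {xs = y ∷ ys} (here refl) fx<gx = +-mono-<-≤ fx<gx (sum-map-mono ys)
  sum-map-strict {xs = y ∷ ys} (there x∈) fx<gx = +-mono-≤-< (f≤g y) (sum-map-strict x∈ fx<gx)

module _ {w : ℕ} (Q : Fin w → Set) where

  pred<-if-¬pred : ∀ {j} → Q j → ¬ Q (pred j) → pred j < j
  pred<-if-¬pred {zero}  Q0 ¬Q0 = contradiction Q0 ¬Q0
  pred<-if-¬pred {suc i} _  _   = pred< (suc i) λ ()

module _ {w : ℕ} (Q : Fin w → Set) (Q-pred : ∀ {j} → Q j → Q (pred j)) where

  pred-closed⇒downward-closed : ∀ {j j′} → j′ ≤ j → Q j → Q j′
  pred-closed⇒downward-closed = go (Fin.<-wellFounded _)
    where
    go : ∀ {j} → Acc _<_ j → ∀ {j′} → j′ ≤ j → Q j → Q j′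
    go {zero}  _             j′≤0 Q0 = subst Q (≤-antisym ℕ.z≤n j′≤0) Q0
    go {suc i} (acc smaller) {j′} j′≤j Qj with j′ ≟ suc i
    ... | yes refl = Qj
    ... | no j′≢j  = go (smaller (pred< (suc i) λ ())) (<⇒≤pred (≤∧≢⇒< j′≤j j′≢j)) (Q-pred Qj)

module Compression {A : Set} (_≟ᴬ_ : DecidableEquality A)
  (Moves : A → Set) (moves? : Decidable Moves) (target : A → A)
  (target-injective : ∀ {x y} → Moves x → Moves y → target x ≡ target y → x ≡ y)
  (targets-stay : ∀ {x} → Moves x → ¬ Moves (target x))
  (P : List A) where

  open DecMembership _≟ᴬ_ using (_∈?_)

  compress : A → A
  compress x with moves? x | target x ∈? P
  ... | yes _ | no _  = target x
  ... | yes _ | yes _ = x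
  ... | no _  | _     = x

  compress-view : ∀ x → compress x ≡ x ⊎ (Moves x × target x ∉ P × compress x ≡ target x)
  compress-view x with moves? x | target x ∈? P
  ... | yes mx | no t∉ = inj₂ (mx , t∉ , refl)
  ... | yes _  | yes _ = inj₁ refl
  ... | no _   | _     = inj₁ refl

  compress-moved : ∀ {x} → Moves x → target x ∉ P → compress x ≡ target x
  compress-moved {x} mx t∉ with moves? x | target x ∈? P
  ... | yes _  | no _   = refl
  ... | yes _  | yes t∈ = contradiction t∈ t∉
  ... | no ¬mx | _      = contradiction mx ¬mx

  ∈-compress : ∀ {x} → x ∈ P → x ∈ map compress P ⊎ (Moves x × target x ∉ P)
  ∈-compress {x} x∈ with compress-view x
  ... | inj₁ fixed          = inj₁ (subst (_∈ map compress P) fixed (∈-map⁺ compress x∈))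
  ... | inj₂ (mx , t∉ , _) = inj₂ (mx , t∉)

  compress-keeps : ∀ {x} → x ∈ P → ¬ Moves x → x ∈ map compress P
  compress-keeps x∈ ¬mx with ∈-compress x∈
  ... | inj₁ x∈′      = x∈′
  ... | inj₂ (mx , _) = contradiction mx ¬mx

  target-∈-compress : ∀ {x} → x ∈ P → Moves x → target x ∈ map compress P
  target-∈-compress {x} x∈ mx with target x ∈? P
  ... | yes t∈ = compress-keeps t∈ (targets-stay mx)
  ... | no t∉  = subst (_∈ map compress P) (compress-moved mx t∉) (∈-map⁺ compress x∈)

  compress-injectiveOn : ∀ {x y} → x ∈ P → y ∈ P → compress x ≡ compress y → x ≡ y
  compress-injectiveOn {x} {y} x∈ y∈ eq with compress-view x | compress-view y
  ... | inj₁ fx | inj₁ fy = trans (sym fx) (trans eq fy)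
  ... | inj₁ fx | inj₂ (_ , t∉ , my) = contradiction (subst (_∈ P) (trans (sym fx) (trans eq my)) x∈) t∉
  ... | inj₂ (_ , t∉ , mx) | inj₁ fy = contradiction (subst (_∈ P) (trans (sym fy) (trans (sym eq) mx)) y∈) t∉
  ... | inj₂ (x↑ , _ , mx) | inj₂ (y↑ , _ , my) =
    target-injective x↑ y↑ (trans (sym mx) (trans eq my))

  unique-compress : Unique P → Unique (map compress P)
  unique-compress = unique-map⁺ compress compress-injectiveOn

  module _ (weight : A → ℕ) (target-lighter : ∀ {x} → Moves x → weight (target x) ℕ.≤ weight x) where

    compress-lighter : ∀ x → weight (compress x) ℕ.≤ weight x
    compress-lighter x with compress-view x
    ... | inj₁ fixed           = subst (λ y → weight y ℕ.≤ weight x) (sym fixed) ≤-refl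
    ... | inj₂ (mx , _ , moved) = subst (λ y → weight y ℕ.≤ weight x) (sym moved) (target-lighter mx)

    sum-weight-compress< : ∀ {x} → x ∈ P → Moves x → target x ∉ P → weight (target x) ℕ.< weight x →
                           sum (map weight (map compress P)) ℕ.< sum (map weight P)
    sum-weight-compress< {x} x∈ mx t∉ lighter = begin-strict
      sum (map weight (map compress P))  ≡⟨ cong sum (map-∘ P) ⟨
      sum (map (weight ∘ compress) P)    <⟨ sum-map-strict compress-lighter x∈ lighter′ ⟩
      sum (map weight P)                 ∎
      where
      open Data.Nat.Properties.≤-Reasoning
      lighter′ : weight (compress x) ℕ.< weight x
      lighter′ = subst (λ y → weight y ℕ.< weight x) (sym (compress-moved mx t∉)) lighter

module _ {m w : ℕ} where

  infix 4 _≟ᴾ_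
  _≟ᴾ_ : DecidableEquality (Pair m w)
  rc i j ≟ᴾ rc i′ j′ = map′ (λ { (refl , refl) → refl }) (λ { refl → refl , refl }) (i ≟ i′ ×-dec j ≟ j′)
  rs i k ≟ᴾ rs i′ k′ = map′ (λ { (refl , refl) → refl }) (λ { refl → refl , refl }) (i ≟ i′ ×-dec k ≟ k′)
  cs j k ≟ᴾ cs j′ k′ = map′ (λ { (refl , refl) → refl }) (λ { refl → refl , refl }) (j ≟ j′ ×-dec k ≟ k′)
  rc _ _ ≟ᴾ rs _ _ = no λ ()
  rc _ _ ≟ᴾ cs _ _ = no λ ()
  rs _ _ ≟ᴾ rc _ _ = no λ ()
  rs _ _ ≟ᴾ cs _ _ = no λ ()
  cs _ _ ≟ᴾ rc _ _ = no λ ()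
  cs _ _ ≟ᴾ rs _ _ = no λ ()

  open DecMembership _≟ᴾ_ using (_∈?_)

  Covers : (Fin m → ℕ) → List (Pair m w) → Set
  Covers a P = ∀ (i : Fin m) (j k : Fin w) → toℕ j ℕ.< a i → toℕ k ℕ.< a i →
    rc i j ∈ P ⊎ rs i k ∈ P ⊎ cs j k ∈ P

  weight : Pair m w → ℕ
  weight (cs j k) = toℕ j + toℕ k
  weight _        = 0

  totalWeight : List (Pair m w) → ℕ
  totalWeight P = sum (map weight P)

  LighterCover : (Fin m → ℕ) → List (Pair m w) → List (Pair m w) → Set
  LighterCover a P P₁ =
    Unique P₁ × Covers a P₁ × length P₁ ≡ length P × totalWeight P₁ ℕ.< totalWeight P

  module ColumnShift (a : Fin m → ℕ) {p q : Fin w} (p<q : p < q) (P : List (Pair m w)) where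

    Moves : Pair m w → Set
    Moves (rc i j) = j ≡ p × toℕ q ℕ.< a i
    Moves (rs _ _) = ⊥
    Moves (cs j _) = j ≡ q

    moves? : Decidable Moves
    moves? (rc i j) = j ≟ p ×-dec toℕ q <? a i
    moves? (rs _ _) = no λ ()
    moves? (cs j _) = j ≟ q

    target : Pair m w → Pair m w
    target (rc i _) = rc i q
    target (rs i k) = rs i k
    target (cs _ k) = cs p k

    target-injective : ∀ {x y} → Moves x → Moves y → target x ≡ target y → x ≡ y
    target-injective {rc _ _} {rc _ _} (refl , _) (refl , _) refl = refl
    target-injective {cs _ _} {cs _ _} refl refl refl = refl
    target-injective {rc _ _} {cs _ _} _ _ ()
    target-injective {cs _ _} {rc _ _} _ _ ()

    targets-stay : ∀ {x} → Moves x → ¬ Moves (target x)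
    targets-stay {rc _ _} _ (q≡p , _) = <⇒≢ p<q (sym q≡p)
    targets-stay {cs _ _} _ p≡q       = <⇒≢ p<q p≡q

    target-lighter : ∀ {x} → Moves x → weight (target x) ℕ.≤ weight x
    target-lighter {rc _ _} _    = ℕ.z≤n
    target-lighter {cs _ k} refl = +-monoˡ-≤ (toℕ k) (<⇒≤ p<q)

    open Compression _≟ᴾ_ Moves moves? target target-injective targets-stay P

    -- An edge {r_i, c_j, s_k} whose covering pair moved is covered again by the
    -- pair that covered {r_i, c_q, s_k} (for j = p) or {r_i, c_p, s_k} (for j = q).
    covers-compress : Covers a P → Covers a (map compress P)
    covers-compress cover i j k j<aᵢ k<aᵢ with cover i j k j<aᵢ k<aᵢ
    ... | inj₂ (inj₁ rs∈) = inj₂ (inj₁ (compress-keeps rs∈ λ ()))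
    ... | inj₁ rc∈ with ∈-compress rc∈
    ...   | inj₁ rc∈′ = inj₁ rc∈′
    ...   | inj₂ ((refl , q<aᵢ) , rcq∉) with cover i q k q<aᵢ k<aᵢ
    ...     | inj₁ rcq∈        = contradiction rcq∈ rcq∉
    ...     | inj₂ (inj₁ rs∈)  = inj₂ (inj₁ (compress-keeps rs∈ λ ()))
    ...     | inj₂ (inj₂ csq∈) = inj₂ (inj₂ (target-∈-compress csq∈ refl))
    covers-compress cover i j k j<aᵢ k<aᵢ | inj₂ (inj₂ cs∈) with ∈-compress cs∈
    ...   | inj₁ cs∈′ = inj₂ (inj₂ cs∈′)
    ...   | inj₂ (refl , csp∉) with cover i p k (<-trans p<q j<aᵢ) k<aᵢ
    ...     | inj₁ rcp∈        = inj₁ (target-∈-compress rcp∈ (refl , j<aᵢ))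
    ...     | inj₂ (inj₁ rs∈)  = inj₂ (inj₁ (compress-keeps rs∈ λ ()))
    ...     | inj₂ (inj₂ csp∈) = contradiction csp∈ csp∉

    lighterCover : ∀ {k} → cs q k ∈ P → cs p k ∉ P → Unique P → Covers a P →
                   LighterCover a P (map compress P)
    lighterCover {k} csq∈ csp∉ P! cover =
      unique-compress P! , covers-compress cover , length-map compress P ,
      sum-weight-compress< weight target-lighter csq∈ refl csp∉ (+-monoˡ-< (toℕ k) p<q)

  transpose : Pair m w → Pair m w
  transpose (rc i j) = rs i j
  transpose (rs i k) = rc i k
  transpose (cs j k) = cs k j

  transpose-involutive : ∀ x → transpose (transpose x) ≡ x
  transpose-involutive (rc _ _) = refl
  transpose-involutive (rs _ _) = refl
  transpose-involutive (cs _ _) = refl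

  transpose-injective : ∀ {x y} → transpose x ≡ transpose y → x ≡ y
  transpose-injective {x} {y} eq =
    trans (sym (transpose-involutive x)) (trans (cong transpose eq) (transpose-involutive y))

  ∈-map-transpose⁻ : ∀ {x P} → x ∈ map transpose P → transpose x ∈ P
  ∈-map-transpose⁻ {P = P} x∈ with ∈-map⁻ transpose x∈
  ... | y , y∈ , refl = subst (_∈ P) (sym (transpose-involutive y)) y∈

  weight-transpose : ∀ x → weight (transpose x) ≡ weight x
  weight-transpose (rc _ _) = refl
  weight-transpose (rs _ _) = refl
  weight-transpose (cs j k) = +-comm (toℕ k) (toℕ j)

  totalWeight-transpose : ∀ P → totalWeight (map transpose P) ≡ totalWeight P
  totalWeight-transpose P = trans (cong sum (sym (map-∘ P))) (cong sum (map-cong weight-transpose P))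

  covers-transpose : ∀ {a P} → Covers a P → Covers a (map transpose P)
  covers-transpose cover i j k j<aᵢ k<aᵢ with cover i k j k<aᵢ j<aᵢ
  ... | inj₁ rc∈        = inj₂ (inj₁ (∈-map⁺ transpose rc∈))
  ... | inj₂ (inj₁ rs∈) = inj₁ (∈-map⁺ transpose rs∈)
  ... | inj₂ (inj₂ cs∈) = inj₂ (inj₂ (∈-map⁺ transpose cs∈))

  unique-transpose : ∀ {P} → Unique P → Unique (map transpose P)
  unique-transpose = Unique.map⁺ transpose-injective

  lighterCover-transpose : ∀ {a P T} → LighterCover a (map transpose P) T →
                           LighterCover a P (map transpose T)
  lighterCover-transpose {P = P} {T} (T! , cover , |T|≡ , lighter) =
    unique-transpose T! , covers-transpose cover ,
    trans (length-map transpose T) (trans |T|≡ (length-map transpose P)) ,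
    subst₂ ℕ._<_ (sym (totalWeight-transpose T)) (totalWeight-transpose P) lighter

  -- Since pred zero = zero, the corresponding half is trivial when j or k is zero.
  NeighboursIn : List (Pair m w) → Pair m w → Set
  NeighboursIn P (cs j k) = cs (pred j) k ∈ P × cs j (pred k) ∈ P
  NeighboursIn P _        = ⊤

  neighboursIn? : ∀ P → Decidable (NeighboursIn P)
  neighboursIn? P (rc _ _) = yes tt
  neighboursIn? P (rs _ _) = yes tt
  neighboursIn? P (cs j k) = cs (pred j) k ∈? P ×-dec cs j (pred k) ∈? P

  locallyClosed⇒closedDown : ∀ {P : List (Pair m w)} → All (NeighboursIn P) P → ClosedDownCS P
  locallyClosed⇒closedDown {P} local j k j′ k′ cs∈ j′≤j k′≤k =
    pred-closed⇒downward-closed (λ k → cs j′ k ∈ P) (proj₂ ∘ All.lookup local) k′≤k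
      (pred-closed⇒downward-closed (λ j → cs j k ∈ P) (proj₁ ∘ All.lookup local) j′≤j cs∈)

  lighterCover-from-defect : ∀ {a P x} → Unique P → Covers a P → x ∈ P → ¬ NeighboursIn P x →
                             ∃ (LighterCover a P)
  lighterCover-from-defect {x = rc _ _} _ _ _ ¬nbrs = contradiction tt ¬nbrs
  lighterCover-from-defect {x = rs _ _} _ _ _ ¬nbrs = contradiction tt ¬nbrs
  lighterCover-from-defect {a} {P} {cs j k} P! cover cs∈ ¬nbrs with cs (pred j) k ∈? P
  ... | no left∉ =
    _ , ColumnShift.lighterCover a (pred<-if-¬pred (λ j → cs j k ∈ P) cs∈ left∉) P cs∈ left∉ P! cover
  ... | yes left∈ =
    _ , lighterCover-transpose {P = P}
          (ColumnShift.lighterCover a (pred<-if-¬pred (λ k → cs k j ∈ Pᵀ) cs∈ᵀ below∉ᵀ) Pᵀ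
             cs∈ᵀ below∉ᵀ (unique-transpose P!) (covers-transpose cover))
    where
    Pᵀ : List (Pair m w)
    Pᵀ = map transpose P
    cs∈ᵀ : cs k j ∈ Pᵀ
    cs∈ᵀ = ∈-map⁺ transpose cs∈
    below∉ᵀ : cs (pred k) j ∉ Pᵀ
    below∉ᵀ below∈ᵀ = ¬nbrs (left∈ , ∈-map-transpose⁻ below∈ᵀ)

  lighterCover-or-locallyClosed : ∀ {a P} → Unique P → Covers a P →
                                  ∃ (LighterCover a P) ⊎ All (NeighboursIn P) P
  lighterCover-or-locallyClosed {P = P} P! cover with all? (neighboursIn? P) P
  ... | yes local = inj₂ local
  ... | no ¬local with find (Allₚ.¬All⇒Any¬ (neighboursIn? P) P ¬local)
  ...   | _ , x∈ , ¬nbrs = inj₁ (lighterCover-from-defect P! cover x∈ ¬nbrs)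

  closeDown : ∀ (a : Fin m → ℕ) P → Acc ℕ._<_ (totalWeight P) → Unique P → Covers a P →
              Σ (List (Pair m w)) λ P′ → Unique P′ × Covers a P′ × length P′ ≡ length P × ClosedDownCS P′
  closeDown a P (acc smaller) P! cover with lighterCover-or-locallyClosed P! cover
  ... | inj₂ local = P , P! , cover , refl , locallyClosed⇒closedDown local
  ... | inj₁ (P₁ , P₁! , cover₁ , |P₁|≡ , P₁<P) with closeDown a P₁ (smaller P₁<P) P₁! cover₁
  ...   | P′ , P′! , cover′ , |P′|≡ , closed = P′ , P′! , cover′ , trans |P′|≡ |P₁|≡ , closed

lemma4p4 : (m : ℕ) (a : Fin m → ℕ) → IsYoung m a →
    (P : List (Pair m (width m a))) → Unique P → Is2Cover m a P →
    Σ (List (Pair m (width m a))) (λ P′ →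
      Unique P′ × Is2Cover m a P′ × length P′ ≡ length P × ClosedDownCS P′)
lemma4p4 m a _ P = closeDown a P (<-wellFounded (totalWeight P))
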